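{- Let $k\geq 0$ be an integer. Every graph that has a cylindrical semi-bar $k$-visibility representation in which all semi-bars have different lengths has a maximal $(k+2)$-quasiplanar convex geometric representation.
   Context: A cylindrical semi-bar $k$-visibility representation of a graph $G=(V,E)$ is a collection $\{s_v\}_{v\in V}$ of pairwise disjoint segments (semi-bars) in $\mathbb{R}^3$ parallel to the $x$-axis with left endpoints on the circle $\{(0,y,z): y^2+z^2=1\}$, such that for all $a,b\in V$, $\{a,b\}\in E$ if and only if there is a circular arc on the surface of the cylinder $y^2+z^2=1$ lying in a plane parallel to the $yz$-plane (a sightline) which intersects $s_a$, $s_b$, and at most $k$ other semi-bars. A $(k+2)$-quasiplanar convex geometric representation of a graph is a drawing of it in the plane with vertices as points in convex position and edges as straight segments such that no $k+2$ edges are pairwise crossing. Such a representation is maximal if adding any further straight segment between two of its (non-adjacent) vertices creates $k+2$ pairwise crossing edges.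
   Formalization: The semi-bar lengths and left endpoints, the sightline planes and arc endpoints, and the points of the convex drawing are taken with rational coordinates rather than real ones. -}

module Defs where

open import Data.Nat using (ℕ; zero; suc; _+_)
open import Data.Fin using (Fin)
import Data.Fin as F
open import Data.Rational using (ℚ; 0ℚ; 1ℚ; _≤_; _<_) renaming (_+_ to _+q_; _*_ to _*q_; _-_ to _-q_)
open import Data.Product using (Σ; _×_; _,_; ∃)
open import Data.Sum using (_⊎_)
open import Data.Unit using (⊤)
open import Data.Empty using (⊥)
open import Relation.Binary.PropositionalEquality using (_≡_; _≢_)
open import Relation.Nullary using (¬_)
open import Function.Definitions using (Injective)

record Graph (n : ℕ) : Set₁ where
  field
    Adj    : Fin n → Fin n → Set
    sym    : ∀ {a b} → Adj a b → Adj b a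
    irrefl : ∀ {a} → ¬ Adj a a
open Graph public

Point : Set
Point = ℚ × ℚ

onUnitCircle : Point → Set
onUnitCircle (y , z) = (y *q y) +q (z *q z) ≡ 1ℚ

orient : Point → Point → Point → ℚ
orient (py , pz) (ry , rz) (qy , qz) =
  ((ry -q py) *q (qz -q pz)) -q ((rz -q pz) *q (qy -q py))

data Arc : Set where
  fullCircle : Arc
  ccwArc     : Point → Point → Arc

IsArc : Arc → Set
IsArc fullCircle   = ⊤
IsArc (ccwArc P Q) = onUnitCircle P × onUnitCircle Q × P ≢ Q

-- membership of a point R of the unit circle in an arc:
-- R lies strictly on the ccw arc from P to Q iff orient P R Q > 0.
OnArc : Point → Arc → Set
OnArc R fullCircle   = ⊤
OnArc R (ccwArc P Q) = R ≡ P ⊎ R ≡ Q ⊎ 0ℚ < orient P R Q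

-- A sightline: circular arc on the cylinder y²+z²=1 lying in the plane x = c.
record Sightline : Set where
  constructor sightline
  field
    xcoord : ℚ
    arc    : Arc
    valid  : IsArc arc
open Sightline public

-- semi-bar of v = segment {(x, pos v) : 0 ≤ x ≤ len v}
record SemiBars (n : ℕ) : Set where
  field
    pos      : Fin n → Point
    len      : Fin n → ℚ
    onCircle : ∀ v → onUnitCircle (pos v)
    lenPos   : ∀ v → 0ℚ < len v
    -- pairwise disjoint semi-bars (all contain their left endpoint at x = 0,
    -- so disjointness is exactly distinctness of the left endpoints)
    disjoint : ∀ v w → v ≢ w → pos v ≢ pos w
open SemiBars public

Meets : ∀ {n} → SemiBars n → Sightline → Fin n → Set
Meets B s v = (0ℚ ≤ xcoord s) × (xcoord s ≤ len B v) × OnArc (pos B v) (arc s)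

MeetsAtMostOthers : ∀ {n} → ℕ → SemiBars n → Sightline → Fin n → Fin n → Set
MeetsAtMostOthers {n} k B s a b =
  (f : Fin (suc k) → Fin n) → Injective _≡_ _≡_ f →
  (∀ i → (f i ≢ a) × (f i ≢ b) × Meets B s (f i)) → ⊥

Sees : ∀ {n} → ℕ → SemiBars n → Fin n → Fin n → Set
Sees k B a b = Σ Sightline λ s → Meets B s a × Meets B s b × MeetsAtMostOthers k B s a b

IsCylSemiBarRep : ∀ {n} → ℕ → Graph n → SemiBars n → Set
IsCylSemiBarRep k G B =
  ∀ a b → a ≢ b → (Adj G a b → Sees k B a b) × (Sees k B a b → Adj G a b)

HasCylSemiBarRepDistinctLengths : ∀ {n} → ℕ → Graph n → Set
HasCylSemiBarRepDistinctLengths {n} k G =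
  Σ (SemiBars n) λ B → IsCylSemiBarRep k G B × Injective _≡_ _≡_ (len B)

sumFin : ∀ {n} → (Fin n → ℚ) → ℚ
sumFin {zero}  f = 0ℚ
sumFin {suc n} f = f F.zero +q sumFin (λ i → f (F.suc i))

fstP sndP : Point → ℚ
fstP (y , _) = y
sndP (_ , z) = z

InHullOfOthers : ∀ {n} → (Fin n → Point) → Fin n → Set
InHullOfOthers {n} q v = Σ (Fin n → ℚ) λ λw →
  (∀ w → 0ℚ ≤ λw w) × (λw v ≡ 0ℚ) × (sumFin λw ≡ 1ℚ) ×
  (sumFin (λ w → λw w *q fstP (q w)) ≡ fstP (q v)) ×
  (sumFin (λ w → λw w *q sndP (q w)) ≡ sndP (q v))

ConvexPosition : ∀ {n} → (Fin n → Point) → Set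
ConvexPosition q = ∀ v → ¬ InHullOfOthers q v

lerp : ℚ → Point → Point → Point
lerp s (py , pz) (qy , qz) =
  (((1ℚ -q s) *q py) +q (s *q qy)) , (((1ℚ -q s) *q pz) +q (s *q qz))

Edge : ℕ → Set
Edge n = Fin n × Fin n

Cross : ∀ {n} → (Fin n → Point) → Edge n → Edge n → Set
Cross q (a , b) (c , d) =
  (a ≢ c) × (a ≢ d) × (b ≢ c) × (b ≢ d) ×
  Σ ℚ λ s → Σ ℚ λ t → (0ℚ ≤ s) × (s ≤ 1ℚ) × (0ℚ ≤ t) × (t ≤ 1ℚ) ×
    (lerp s (q a) (q b) ≡ lerp t (q c) (q d))

PairwiseCrossingFamily : ∀ {n} → (Fin n → Point) → (Edge n → Set) → ℕ → Set
PairwiseCrossingFamily {n} q P m = Σ (Fin m → Edge n) λ e →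
  (∀ i → P (e i)) × (∀ i j → i ≢ j → Cross q (e i) (e j))

IsEdge : ∀ {n} → Graph n → Edge n → Set
IsEdge G (a , b) = Adj G a b

-- convex geometric representation of G: vertices as points in convex
-- position, edges = straight segments between adjacent vertices
record ConvexGeomRep {n} (G : Graph n) : Set where
  field
    pt     : Fin n → Point
    convex : ConvexPosition pt
open ConvexGeomRep public

Quasiplanar : ∀ {n} {G : Graph n} → ℕ → ConvexGeomRep G → Set
Quasiplanar {G = G} k C = ¬ PairwiseCrossingFamily (pt C) (IsEdge G) (k + 2)

MaximalQuasiplanar : ∀ {n} {G : Graph n} → ℕ → ConvexGeomRep G → Set
MaximalQuasiplanar {G = G} k C =
  Quasiplanar k C ×
  (∀ a b → a ≢ b → ¬ Adj G a b →
     PairwiseCrossingFamily (pt C)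
       (λ e → IsEdge G e ⊎ e ≡ (a , b) ⊎ e ≡ (b , a)) (k + 2))

{-# OPTIONS --safe #-}

-- The left endpoints of the semi-bars are distinct points of the unit circle, hence in convex
-- position, and two chords between them cross exactly when their endpoints alternate in the
-- counterclockwise order.  That order is the sign of the orientation determinant, and everything
-- needed about it reduces to polynomial identities over ℚ modulo the circle equations.
--
-- No k+2 edges cross pairwise: among such edges take one, ab, whose shorter end is shortest.  A
-- sightline witnessing ab meets every bar on its arc at least as long as the shorter of a and b.
-- Each of the other k+1 edges crosses ab, so one of its ends lies on that arc, and these ends are
-- distinct: the sightline meets k+1 further bars.
--
-- Maximality: let a, b be non-adjacent, b the shorter.  On either arc between b and a the
-- sightline at the height of b meets at least k+1 bars taller than b, as otherwise a would see b.
-- Let x₀, …, x_k be the first k+1 of them counterclockwise from b and y₀, …, y_k the first k+1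
-- clockwise.  Along the arc from y_{k-i} through b to x_i at height min(len x_i, len y_{k-i}) only
-- x₀, …, x_{i-1} and y₀, …, y_{k-i-1} are met, so x_i sees y_{k-i}; the k+1 chords x_i y_{k-i}
-- and the segment ab cross pairwise.

module Submission where

open import Defs hiding (sym)

open import Axiom.UniquenessOfIdentityProofs using (module Decidable⇒UIP)
open import Data.Empty using (⊥; ⊥-elim)
open import Data.Fin as Fin using (Fin; zero; suc; toℕ; opposite; punchIn)
open import Data.Fin.Induction using (spo-wellFounded)
import Data.Fin.Properties as Finₚ
open import Data.List using (List; []; _∷_; _++_; length; lookup; allFin)
open import Data.List.Membership.Propositional using (_∈_)
open import Data.List.Membership.Propositional.Properties using (∈-allFin; ∈-++⁺ˡ; ∈-++⁺ʳ)
import Data.List.Properties as Listₚ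
import Data.List.Relation.Unary.All as All
open import Data.List.Relation.Unary.Any using (here; there; index)
open import Data.List.Relation.Unary.Any.Properties using (lookup-index)
open import Data.Nat as ℕ using (ℕ; zero; suc; z≤n; s≤s)
import Data.Nat.Properties as ℕₚ
open import Data.Product using (Σ; Σ-syntax; ∃; _×_; _,_; proj₁; proj₂)
open import Data.Product.Properties using (≡-dec)
open import Data.Rational as ℚ using (ℚ; 0ℚ; 1ℚ; -_; _+_; _*_; _-_; _<_; _≤_; _⊓_; 1/_)
import Data.Rational.Properties as ℚₚ
open import Data.Rational.Solver using (module +-*-Solver)
open import Data.Sum as Sum using (_⊎_; inj₁; inj₂)
open import Data.Unit using (tt)
open import Function using (_∘_; id; flip)
open import Function.Definitions using (Injective)
open import Induction.WellFounded using (Acc; acc)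
open import Level using (0ℓ)
open import Relation.Binary
  using (Rel; Decidable; DecidableEquality; IsStrictPartialOrder; DecTotalOrder; Tri; tri<; tri≈; tri>)
import Relation.Binary.Construct.Flip.EqAndOrd as Flip
open import Relation.Binary.PropositionalEquality
open import Relation.Nullary using (¬_; Dec; yes; no)
open import Relation.Nullary.Decidable using (_×-dec_; _⊎-dec_; map′; decidable-stable)
open import Relation.Unary as U using (Pred)

open import Algebra.Properties.Group ℚₚ.+-0-group using (x∙y⁻¹≈ε⇒x≈y)
open import Data.List.Extrema (DecTotalOrder.totalOrder ℚₚ.≤-decTotalOrder)
  using (argmin; f[argmin]≤f[xs])
open +-*-Solver using (solve; _:=_; _:+_; _:*_; _:-_; :-_; con; Polynomial)

private
  variable
    p q r s t α β γ δ : ℚ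

0<*0< : 0ℚ < p → 0ℚ < q → 0ℚ < p * q
0<*0< {p} {q} 0<p 0<q =
  ℚₚ.positive⁻¹ (p * q) {{ℚₚ.pos*pos⇒pos p {{ℚ.positive 0<p}} q {{ℚ.positive 0<q}}}}

0≤*0≤ : 0ℚ ≤ p → 0ℚ ≤ q → 0ℚ ≤ p * q
0≤*0≤ {p} {q} 0≤p 0≤q =
  ℚₚ.nonNegative⁻¹ (p * q) {{ℚₚ.nonNeg*nonNeg⇒nonNeg p {{ℚ.nonNegative 0≤p}} q {{ℚ.nonNegative 0≤q}}}}

0<*-cancelʳ : 0ℚ < r → 0ℚ < p * r → 0ℚ < p
0<*-cancelʳ {r} {p} 0<r 0<pr =
  ℚₚ.*-cancelʳ-<-nonNeg r {{ℚ.nonNegative (ℚₚ.<⇒≤ 0<r)}}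
    (subst (_< p * r) (sym (ℚₚ.*-zeroˡ r)) 0<pr)

p≢0⇒0<p*p : p ≢ 0ℚ → 0ℚ < p * p
p≢0⇒0<p*p {p} p≢0 with ℚₚ.<-cmp p 0ℚ
... | tri< p<0 _ _ = ℚₚ.positive⁻¹ (p * p) {{ℚₚ.neg*neg⇒pos p {{ℚ.negative p<0}} p {{ℚ.negative p<0}}}}
... | tri≈ _ p≡0 _ = ⊥-elim (p≢0 p≡0)
... | tri> _ _ 0<p = 0<*0< 0<p 0<p

0≤p*p : ∀ p → 0ℚ ≤ p * p
0≤p*p p with p ℚ.≟ 0ℚ
... | yes refl = ℚₚ.≤-refl
... | no p≢0 = ℚₚ.<⇒≤ (p≢0⇒0<p*p p≢0)

0<p+p⇒0<p : 0ℚ < p + p → 0ℚ < p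
0<p+p⇒0<p {p} 0<2p = ℚₚ.≰⇒> λ p≤0 →
  ℚₚ.<-irrefl {0ℚ} refl (ℚₚ.<-≤-trans 0<2p (ℚₚ.+-mono-≤ {p} {0ℚ} {p} {0ℚ} p≤0 p≤0))

0≤p+p⇒0≤p : 0ℚ ≤ p + p → 0ℚ ≤ p
0≤p+p⇒0≤p {p} 0≤2p = ℚₚ.≮⇒≥ λ p<0 →
  ℚₚ.<-irrefl {0ℚ} refl (ℚₚ.≤-<-trans 0≤2p (ℚₚ.+-mono-< {p} {0ℚ} {p} {0ℚ} p<0 p<0))

*-cancelˡ-≢0 : r ≢ 0ℚ → r * p ≡ r * q → p ≡ q
*-cancelˡ-≢0 {r} {p} {q} r≢0 rp≡rq = begin
  p                 ≡⟨ ℚₚ.*-identityˡ p ⟨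
  1ℚ * p            ≡⟨ cong (_* p) (sym r⁻¹r≡1) ⟩
  (r⁻¹ * r) * p     ≡⟨ ℚₚ.*-assoc r⁻¹ r p ⟩
  r⁻¹ * (r * p)     ≡⟨ cong (r⁻¹ *_) rp≡rq ⟩
  r⁻¹ * (r * q)     ≡⟨ ℚₚ.*-assoc r⁻¹ r q ⟨
  (r⁻¹ * r) * q     ≡⟨ cong (_* q) r⁻¹r≡1 ⟩
  1ℚ * q            ≡⟨ ℚₚ.*-identityˡ q ⟩
  q                 ∎
  where
  open ≡-Reasoning
  r⁻¹ : ℚ
  r⁻¹ = (1/ r) {{ℚ.≢-nonZero r≢0}}
  r⁻¹r≡1 : r⁻¹ * r ≡ 1ℚ
  r⁻¹r≡1 = ℚₚ.*-inverseˡ r {{ℚ.≢-nonZero r≢0}}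

p*q≡0⇒p≡0 : q ≢ 0ℚ → p * q ≡ 0ℚ → p ≡ 0ℚ
p*q≡0⇒p≡0 {q} {p} q≢0 pq≡0 =
  *-cancelˡ-≢0 q≢0 (trans (ℚₚ.*-comm q p) (trans pq≡0 (sym (ℚₚ.*-zeroʳ q))))

≤∧≢⇒< : p ≤ q → p ≢ q → p < q
≤∧≢⇒< {p} {q} p≤q p≢q with ℚₚ.<-cmp p q
... | tri< p<q _ _ = p<q
... | tri≈ _ p≡q _ = ⊥-elim (p≢q p≡q)
... | tri> _ _ q<p = ⊥-elim (ℚₚ.<-irrefl refl (ℚₚ.<-≤-trans q<p p≤q))

<-⊓ : r < p → r < q → r < p ⊓ q
<-⊓ {r} {p} {q} r<p r<q =
  Sum.[ (λ e → subst (r <_) (sym e) r<p) , (λ e → subst (r <_) (sym e) r<q) ]′ (ℚₚ.⊓-sel p q)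

drop-vanishing : r ≡ q → ∀ p g → p + (r - q) * g ≡ p
drop-vanishing {q = q} refl p g = solve 3 (λ p q g → p :+ (q :- q) :* g := p) refl p q g

dot det sqDist versin : Point → Point → ℚ
dot (x₁ , x₂) (y₁ , y₂) = x₁ * y₁ + x₂ * y₂
det (x₁ , x₂) (y₁ , y₂) = x₁ * y₂ - x₂ * y₁
sqDist (x₁ , x₂) (y₁ , y₂) = (x₁ - y₁) * (x₁ - y₁) + (x₂ - y₂) * (x₂ - y₂)
versin x y = 1ℚ - dot x y

-- Solver syntax mirroring dot, det, sqDist, versin, orient and lerp clause by clause, so that the
-- semantics of each is definitionally the function it mirrors and `solve … refl` applies.
module Expr {m : ℕ} where

  Vec² : Set
  Vec² = Polynomial m × Polynomial m

  1ₑ : Polynomial m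
  1ₑ = con 1ℚ

  dotₑ detₑ sqDistₑ versinₑ : Vec² → Vec² → Polynomial m
  dotₑ (x₁ , x₂) (y₁ , y₂) = x₁ :* y₁ :+ x₂ :* y₂
  detₑ (x₁ , x₂) (y₁ , y₂) = x₁ :* y₂ :- x₂ :* y₁
  sqDistₑ (x₁ , x₂) (y₁ , y₂) = (x₁ :- y₁) :* (x₁ :- y₁) :+ (x₂ :- y₂) :* (x₂ :- y₂)
  versinₑ x y = 1ₑ :- dotₑ x y

  orientₑ : Vec² → Vec² → Vec² → Polynomial m
  orientₑ (p₁ , p₂) (r₁ , r₂) (q₁ , q₂) = ((r₁ :- p₁) :* (q₂ :- p₂)) :- ((r₂ :- p₂) :* (q₁ :- p₁))

  lerpₑ : Polynomial m → Vec² → Vec² → Vec²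
  lerpₑ s (p₁ , p₂) (q₁ , q₂) = ((1ₑ :- s) :* p₁) :+ (s :* q₁) , ((1ₑ :- s) :* p₂) :+ (s :* q₂)

open Expr

orient-rotate : ∀ x y z → orient x y z ≡ orient y z x
orient-rotate (x₁ , x₂) (y₁ , y₂) (z₁ , z₂) = solve 6 (λ x₁ x₂ y₁ y₂ z₁ z₂ →
  let x = x₁ , x₂ ; y = y₁ , y₂ ; z = z₁ , z₂ in
  orientₑ x y z := orientₑ y z x) refl x₁ x₂ y₁ y₂ z₁ z₂

orient-swap : ∀ x y z → orient x z y ≡ - orient x y z
orient-swap (x₁ , x₂) (y₁ , y₂) (z₁ , z₂) = solve 6 (λ x₁ x₂ y₁ y₂ z₁ z₂ →
  let x = x₁ , x₂ ; y = y₁ , y₂ ; z = z₁ , z₂ in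
  orientₑ x z y := :- orientₑ x y z) refl x₁ x₂ y₁ y₂ z₁ z₂

orient-degenerate : ∀ x y → orient x y y ≡ 0ℚ
orient-degenerate (x₁ , x₂) (y₁ , y₂) = solve 4 (λ x₁ x₂ y₁ y₂ →
  orientₑ (x₁ , x₂) (y₁ , y₂) (y₁ , y₂) := con 0ℚ) refl x₁ x₂ y₁ y₂

orient-lerp : ∀ a c d b t → orient a (lerp t c d) b ≡ (1ℚ - t) * orient a c b + t * orient a d b
orient-lerp (a₁ , a₂) (c₁ , c₂) (d₁ , d₂) (b₁ , b₂) = solve 9 (λ a₁ a₂ c₁ c₂ d₁ d₂ b₁ b₂ t →
  let a = a₁ , a₂ ; b = b₁ , b₂ ; c = c₁ , c₂ ; d = d₁ , d₂ in
  orientₑ a (lerpₑ t c d) b := (1ₑ :- t) :* orientₑ a c b :+ t :* orientₑ a d b)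
  refl a₁ a₂ c₁ c₂ d₁ d₂ b₁ b₂

orient-lerp-self : ∀ a b s → orient a (lerp s a b) b ≡ 0ℚ
orient-lerp-self (a₁ , a₂) (b₁ , b₂) = solve 5 (λ a₁ a₂ b₁ b₂ s →
  let a = a₁ , a₂ ; b = b₁ , b₂ in
  orientₑ a (lerpₑ s a b) b := con 0ℚ) refl a₁ a₂ b₁ b₂

-- The identities below that hold only on the unit circle carry an extra term (dot x x - 1) * g,
-- removed afterwards with drop-vanishing.
sqDist-versin : ∀ x y →
  sqDist x y ≡ versin x y + versin x y + (dot x x - 1ℚ) * 1ℚ + (dot y y - 1ℚ) * 1ℚ
sqDist-versin (x₁ , x₂) (y₁ , y₂) = solve 4 (λ x₁ x₂ y₁ y₂ →
  let x = x₁ , x₂ ; y = y₁ , y₂ in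
  sqDistₑ x y := versinₑ x y :+ versinₑ x y :+ (dotₑ x x :- 1ₑ) :* 1ₑ :+ (dotₑ y y :- 1ₑ) :* 1ₑ)
  refl x₁ x₂ y₁ y₂

orient-versin : ∀ x y z →
  orient x y z ≡ det x y * versin x z - det x z * versin x y + (dot x x - 1ℚ) * det z y
orient-versin (x₁ , x₂) (y₁ , y₂) (z₁ , z₂) = solve 6 (λ x₁ x₂ y₁ y₂ z₁ z₂ →
  let x = x₁ , x₂ ; y = y₁ , y₂ ; z = z₁ , z₂ in
  orientₑ x y z := detₑ x y :* versinₑ x z :- detₑ x z :* versinₑ x y :+ (dotₑ x x :- 1ₑ) :* detₑ z y)
  refl x₁ x₂ y₁ y₂ z₁ z₂

det-versin : ∀ x y →
  det x y * det x y ≡ versin x y * (1ℚ + dot x y) + (dot x x * dot y y - 1ℚ) * 1ℚ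
det-versin (x₁ , x₂) (y₁ , y₂) = solve 4 (λ x₁ x₂ y₁ y₂ →
  let x = x₁ , x₂ ; y = y₁ , y₂ in
  detₑ x y :* detₑ x y := versinₑ x y :* (1ₑ :+ dotₑ x y) :+ (dotₑ x x :* dotₑ y y :- 1ₑ) :* 1ₑ)
  refl x₁ x₂ y₁ y₂

versin-triangle : ∀ x y z →
  versin x y + versin x z - versin x y * versin x z - det x y * det x z
    ≡ versin y z + (dot x x - 1ℚ) * (- dot y z)
versin-triangle (x₁ , x₂) (y₁ , y₂) (z₁ , z₂) = solve 6 (λ x₁ x₂ y₁ y₂ z₁ z₂ →
  let x = x₁ , x₂ ; y = y₁ , y₂ ; z = z₁ , z₂ in
  versinₑ x y :+ versinₑ x z :- versinₑ x y :* versinₑ x z :- detₑ x y :* detₑ x z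
    := versinₑ y z :+ (dotₑ x x :- 1ₑ) :* (:- dotₑ y z))
  refl x₁ x₂ y₁ y₂ z₁ z₂

orient-versin-transfer : ∀ b u v w →
  orient b u v * versin b w + orient b v w * versin b u
    ≡ orient b u w * versin b v + (dot b b - 1ℚ) * orient u w v
orient-versin-transfer (b₁ , b₂) (u₁ , u₂) (v₁ , v₂) (w₁ , w₂) = solve 8 (λ b₁ b₂ u₁ u₂ v₁ v₂ w₁ w₂ →
  let b = b₁ , b₂ ; u = u₁ , u₂ ; v = v₁ , v₂ ; w = w₁ , w₂ in
  orientₑ b u v :* versinₑ b w :+ orientₑ b v w :* versinₑ b u
    := orientₑ b u w :* versinₑ b v :+ (dotₑ b b :- 1ₑ) :* orientₑ u w v)
  refl b₁ b₂ u₁ u₂ v₁ v₂ w₁ w₂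

square-expansion : ∀ a b D E → let v = 1ℚ - D ; w = 1ℚ - E in
  (a * w - b * v) * (a * w - b * v)
    ≡ (v * w) * ((v + w - v * w - a * b) + (v + w - v * w - a * b))
      + (a * a - v * (1ℚ + D)) * (w * w) + (b * b - w * (1ℚ + E)) * (v * v)
square-expansion = solve 4 (λ a b D E → let v = 1ₑ :- D ; w = 1ₑ :- E in
  (a :* w :- b :* v) :* (a :* w :- b :* v)
    := (v :* w) :* ((v :+ w :- v :* w :- a :* b) :+ (v :+ w :- v :* w :- a :* b))
       :+ (a :* a :- v :* (1ₑ :+ D)) :* (w :* w) :+ (b :* b :- w :* (1ₑ :+ E)) :* (v :* v)) refl

sqDist-pos : ∀ {x y} → x ≢ y → 0ℚ < sqDist x y
sqDist-pos {x₁ , x₂} {y₁ , y₂} x≢y with x₁ - y₁ ℚ.≟ 0ℚ | x₂ - y₂ ℚ.≟ 0ℚ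
... | yes e₁ | yes e₂ = ⊥-elim (x≢y (cong₂ _,_ (x∙y⁻¹≈ε⇒x≈y x₁ y₁ e₁) (x∙y⁻¹≈ε⇒x≈y x₂ y₂ e₂)))
... | no n₁ | _      = ℚₚ.+-mono-<-≤ (p≢0⇒0<p*p n₁) (0≤p*p (x₂ - y₂))
... | yes _ | no n₂  = ℚₚ.+-mono-≤-< (0≤p*p (x₁ - y₁)) (p≢0⇒0<p*p n₂)

sqDist-nonneg : ∀ x y → 0ℚ ≤ sqDist x y
sqDist-nonneg (x₁ , x₂) (y₁ , y₂) = ℚₚ.+-mono-≤ (0≤p*p (x₁ - y₁)) (0≤p*p (x₂ - y₂))

record CirclePoint : Set where
  constructor circlePoint
  field
    coords : Point
    unit   : onUnitCircle coords
open CirclePoint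

private
  variable
    a b c d u v w x y z P Q : CirclePoint

coords-injective : coords x ≡ coords y → x ≡ y
coords-injective {circlePoint X h} {circlePoint .X h′} refl =
  cong (circlePoint X) (Decidable⇒UIP.≡-irrelevant ℚ._≟_ h h′)

orientᶜ : CirclePoint → CirclePoint → CirclePoint → ℚ
orientᶜ x y z = orient (coords x) (coords y) (coords z)

versinᶜ : CirclePoint → CirclePoint → ℚ
versinᶜ x y = versin (coords x) (coords y)

sqDist≡versin+versin : ∀ x y → sqDist (coords x) (coords y) ≡ versinᶜ x y + versinᶜ x y
sqDist≡versin+versin x y =
  trans (sqDist-versin (coords x) (coords y))
    (trans (drop-vanishing (unit y) _ 1ℚ) (drop-vanishing (unit x) _ 1ℚ))

versin-pos : x ≢ y → 0ℚ < versinᶜ x y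
versin-pos {x} {y} x≢y =
  0<p+p⇒0<p (subst (0ℚ <_) (sqDist≡versin+versin x y) (sqDist-pos (x≢y ∘ coords-injective)))

versin-nonneg : ∀ x y → 0ℚ ≤ versinᶜ x y
versin-nonneg x y =
  0≤p+p⇒0≤p (subst (0ℚ ≤_) (sqDist≡versin+versin x y) (sqDist-nonneg (coords x) (coords y)))

-- For a triangle inscribed in the unit circle this is (2·area)² = |xy|²|yz|²|zx|²/4.
orient-squared : ∀ x y z →
  orientᶜ x y z * orientᶜ x y z ≡ (versinᶜ x y * versinᶜ x z) * (versinᶜ y z + versinᶜ y z)
orient-squared x y z = begin
  orientᶜ x y z * orientᶜ x y z                  ≡⟨ cong (λ o → o * o) orient≡ ⟩
  (Dy * Vz - Dz * Vy) * (Dy * Vz - Dz * Vy)      ≡⟨ square-expansion Dy Dz (dot X Y) (dot X Z) ⟩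
  (Vy * Vz) * (T + T) + (Dy * Dy - Vy * (1ℚ + dot X Y)) * (Vz * Vz)
    + (Dz * Dz - Vz * (1ℚ + dot X Z)) * (Vy * Vy) ≡⟨ drop-vanishing (det² (unit z)) _ (Vy * Vy) ⟩
  (Vy * Vz) * (T + T) + (Dy * Dy - Vy * (1ℚ + dot X Y)) * (Vz * Vz)
                                                 ≡⟨ drop-vanishing (det² (unit y)) _ (Vz * Vz) ⟩
  (Vy * Vz) * (T + T)                            ≡⟨ cong (λ e → (Vy * Vz) * (e + e)) T≡ ⟩
  (Vy * Vz) * (versinᶜ y z + versinᶜ y z)        ∎
  where
  open ≡-Reasoning
  X Y Z : Point
  X = coords x
  Y = coords y
  Z = coords z
  Dy Dz Vy Vz T : ℚ
  Dy = det X Y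
  Dz = det X Z
  Vy = versin X Y
  Vz = versin X Z
  T = Vy + Vz - Vy * Vz - Dy * Dz
  orient≡ : orient X Y Z ≡ Dy * Vz - Dz * Vy
  orient≡ = trans (orient-versin X Y Z) (drop-vanishing (unit x) _ _)
  det² : ∀ {W} → onUnitCircle W → det X W * det X W ≡ versin X W * (1ℚ + dot X W)
  det² {W} hW = trans (det-versin X W)
    (drop-vanishing (trans (cong₂ _*_ (unit x) hW) (ℚₚ.*-identityˡ 1ℚ)) _ 1ℚ)
  T≡ : T ≡ versinᶜ y z
  T≡ = trans (versin-triangle X Y Z) (drop-vanishing (unit x) _ _)

orient≢0 : x ≢ y → y ≢ z → z ≢ x → orientᶜ x y z ≢ 0ℚ
orient≢0 {x} {y} {z} x≢y y≢z z≢x o≡0 = ℚₚ.<⇒≢ 0<rhs (begin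
  0ℚ                                                ≡⟨ cong (λ o → o * o) o≡0 ⟨
  orientᶜ x y z * orientᶜ x y z                     ≡⟨ orient-squared x y z ⟩
  (versinᶜ x y * versinᶜ x z) * (versinᶜ y z + versinᶜ y z) ∎)
  where
  open ≡-Reasoning
  0<rhs : 0ℚ < (versinᶜ x y * versinᶜ x z) * (versinᶜ y z + versinᶜ y z)
  0<rhs = 0<*0< (0<*0< (versin-pos x≢y) (versin-pos (z≢x ∘ sym)))
                (ℚₚ.+-mono-< {0ℚ} {_} {0ℚ} (versin-pos y≢z) (versin-pos y≢z))

record Ccw (x y z : CirclePoint) : Set where
  constructor ccw
  field
    orient>0 : 0ℚ < orientᶜ x y z
open Ccw

ccw-rotate : Ccw x y z → Ccw y z x
ccw-rotate {x} {y} {z} (ccw o>0) =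
  ccw (subst (0ℚ <_) (orient-rotate (coords x) (coords y) (coords z)) o>0)

ccw-≢₂₃ : Ccw x y z → y ≢ z
ccw-≢₂₃ {x} {y} (ccw o>0) refl =
  ℚₚ.<-irrefl {0ℚ} refl (subst (0ℚ <_) (orient-degenerate (coords x) (coords y)) o>0)

ccw-≢₃₁ : Ccw x y z → z ≢ x
ccw-≢₃₁ = ccw-≢₂₃ ∘ ccw-rotate

ccw-≢₁₂ : Ccw x y z → x ≢ y
ccw-≢₁₂ = ccw-≢₃₁ ∘ ccw-rotate

orient<0⇒ccw : orientᶜ x y z < 0ℚ → Ccw x z y
orient<0⇒ccw {x} {y} {z} o<0 =
  ccw (subst (0ℚ <_) (sym (orient-swap (coords x) (coords y) (coords z))) (ℚₚ.neg-antimono-< o<0))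

ccw⇒orient<0 : Ccw x y z → orientᶜ x z y < 0ℚ
ccw⇒orient<0 {x} {y} {z} (ccw o>0) =
  subst (_< 0ℚ) (sym (orient-swap (coords x) (coords y) (coords z))) (ℚₚ.neg-antimono-< o>0)

ccw-asym : Ccw x y z → ¬ Ccw x z y
ccw-asym xyz xzy = ℚₚ.<-asym (orient>0 xyz) (ccw⇒orient<0 xzy)

ccw-total : x ≢ y → y ≢ z → z ≢ x → Ccw x y z ⊎ Ccw x z y
ccw-total {x} {y} {z} x≢y y≢z z≢x with ℚₚ.<-cmp 0ℚ (orientᶜ x y z)
... | tri< 0<o _ _ = inj₁ (ccw 0<o)
... | tri≈ _ 0≡o _ = ⊥-elim (orient≢0 x≢y y≢z z≢x (sym 0≡o))
... | tri> _ _ o<0 = inj₂ (orient<0⇒ccw o<0)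

-- By orient-versin-transfer, orient b u w * versin b v is a sum of two positive terms.
ccw-trans : Ccw b u v → Ccw b v w → Ccw b u w
ccw-trans {b} {u} {v} {w} buv@(ccw 0<buv) bvw@(ccw 0<bvw) =
  ccw (0<*-cancelʳ (versin-pos (ccw-≢₁₂ bvw)) 0<buw·v)
  where
  B U V W : Point
  B = coords b
  U = coords u
  V = coords v
  W = coords w
  0<buw·v : 0ℚ < orient B U W * versin B V
  0<buw·v = subst (0ℚ <_)
    (trans (orient-versin-transfer B U V W) (drop-vanishing (unit b) _ _))
    (ℚₚ.+-mono-< {0ℚ} {_} {0ℚ} (0<*0< 0<buv (versin-pos (ccw-≢₃₁ bvw ∘ sym)))
                              (0<*0< 0<bvw (versin-pos (ccw-≢₁₂ buv))))

ccw-between : Ccw b u v → Ccw b v w → Ccw u v w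
ccw-between {b} {u} {v} {w} buv bvw =
  from-total (ccw-total (ccw-≢₂₃ buv) (ccw-≢₂₃ bvw) (ccw-≢₂₃ (ccw-trans buv bvw) ∘ sym))
  where
  from-total : Ccw u v w ⊎ Ccw u w v → Ccw u v w
  from-total (inj₁ uvw) = uvw
  from-total (inj₂ uwv) =
    ⊥-elim (ccw-asym bvw (ccw-rotate (ccw-trans vbu vuw)))
    where
    vbu : Ccw v b u
    vbu = ccw-rotate (ccw-rotate buv)
    vuw : Ccw v u w
    vuw = ccw-rotate (ccw-rotate uwv)

ccw-split : Ccw y b x → Ccw y u x → u ≢ b → Ccw b u x ⊎ Ccw y u b
ccw-split {y} {b} {x} {u} ybx yux u≢b =
  from-total (ccw-total (ccw-≢₁₂ yux) u≢b (ccw-≢₁₂ ybx ∘ sym))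
  where
  from-total : Ccw y u b ⊎ Ccw y b u → Ccw b u x ⊎ Ccw y u b
  from-total (inj₁ yub) = inj₂ yub
  from-total (inj₂ ybu) = inj₁ (ccw-between ybu yux)

InArc : (P Q a : CirclePoint) → Set
InArc P Q a = a ≡ P ⊎ (∀ {c} → Ccw P Q c → Ccw P a c)

on-arc? : ∀ R A → Dec (OnArc R A)
on-arc? R fullCircle   = yes tt
on-arc? R (ccwArc P Q) = R ≟ P ⊎-dec R ≟ Q ⊎-dec 0ℚ ℚ.<? orient P R Q
  where
  _≟_ : DecidableEquality Point
  _≟_ = ≡-dec ℚ._≟_ ℚ._≟_

on-arc⇒InArc : P ≢ Q → OnArc (coords a) (ccwArc (coords P) (coords Q)) → InArc P Q a
on-arc⇒InArc P≢Q (inj₁ a≡P)        = inj₁ (coords-injective a≡P)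
on-arc⇒InArc P≢Q (inj₂ (inj₁ a≡Q)) = inj₂ (subst (λ q → Ccw _ q _) (sym (coords-injective a≡Q)))
on-arc⇒InArc P≢Q (inj₂ (inj₂ o>0)) = inj₂ (ccw-trans (ccw o>0))

off-arc⇒ccw : P ≢ Q → ¬ OnArc (coords c) (ccwArc (coords P) (coords Q)) → Ccw P Q c
off-arc⇒ccw {P} {Q} {c} P≢Q c∉ = from-total (ccw-total P≢c c≢Q (P≢Q ∘ sym))
  where
  P≢c : P ≢ c
  P≢c P≡c = c∉ (inj₁ (cong coords (sym P≡c)))
  c≢Q : c ≢ Q
  c≢Q c≡Q = c∉ (inj₂ (inj₁ (cong coords c≡Q)))
  from-total : Ccw P c Q ⊎ Ccw P Q c → Ccw P Q c
  from-total (inj₁ PcQ) = ⊥-elim (c∉ (inj₂ (inj₂ (orient>0 PcQ))))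
  from-total (inj₂ PQc) = PQc

-- c, d lie beyond the arc from P to Q, so seen from P both come after a and b.
InArc-unseparated : InArc P Q a → InArc P Q b → Ccw P Q c → Ccw P Q d → Ccw a c b → ¬ Ccw a b d
InArc-unseparated (inj₁ refl) (inj₁ refl) _   _   acb _   = ccw-≢₃₁ acb refl
InArc-unseparated (inj₁ refl) (inj₂ b<)   PQc _   acb _   = ccw-asym acb (b< PQc)
InArc-unseparated (inj₂ a<)   (inj₁ refl) _   PQd _   abd = ccw-asym (a< PQd) (ccw-rotate abd)
InArc-unseparated {P} {Q} {a} {b} {c} {d} (inj₂ a<) (inj₂ b<) PQc PQd acb abd =
  from-total (ccw-total (ccw-≢₁₂ (a< PQc)) (ccw-≢₃₁ acb ∘ sym) (ccw-≢₁₂ (b< PQc) ∘ sym))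
  where
  from-total : Ccw P a b ⊎ Ccw P b a → ⊥
  from-total (inj₁ Pab) = ccw-asym (ccw-between Pab (b< PQc)) acb
  from-total (inj₂ Pba) = ccw-asym abd (ccw-rotate (ccw-between Pba (a< PQd)))

Separated : (a b c d : CirclePoint) → Set
Separated a b c d = (Ccw a c b × Ccw a b d) ⊎ (Ccw a d b × Ccw a b c)

separated-meets-arc : ∀ A → IsArc A → OnArc (coords a) A → OnArc (coords b) A →
  Separated a b c d → OnArc (coords c) A ⊎ OnArc (coords d) A
separated-meets-arc fullCircle _ _ _ _ = inj₁ tt
separated-meets-arc {a} {b} {c} {d} (ccwArc P Q) (P-unit , Q-unit , P≢Q) a∈ b∈ sep =
  decide (on-arc? (coords c) (ccwArc P Q)) (on-arc? (coords d) (ccwArc P Q))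
  where
  P′ Q′ : CirclePoint
  P′ = circlePoint P P-unit
  Q′ = circlePoint Q Q-unit
  P′≢Q′ : P′ ≢ Q′
  P′≢Q′ = P≢Q ∘ cong coords
  a∈′ : InArc P′ Q′ a
  a∈′ = on-arc⇒InArc P′≢Q′ a∈
  b∈′ : InArc P′ Q′ b
  b∈′ = on-arc⇒InArc P′≢Q′ b∈
  decide : Dec (OnArc (coords c) (ccwArc P Q)) → Dec (OnArc (coords d) (ccwArc P Q)) →
    OnArc (coords c) (ccwArc P Q) ⊎ OnArc (coords d) (ccwArc P Q)
  decide (yes c∈) _       = inj₁ c∈
  decide (no _)   (yes d∈) = inj₂ d∈
  decide (no c∉)  (no d∉) = ⊥-elim (excluded sep)
    where
    excluded : Separated a b c d → ⊥
    excluded (inj₁ (acb , abd)) =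
      InArc-unseparated a∈′ b∈′ (off-arc⇒ccw P′≢Q′ c∉) (off-arc⇒ccw P′≢Q′ d∉) acb abd
    excluded (inj₂ (adb , abc)) =
      InArc-unseparated a∈′ b∈′ (off-arc⇒ccw P′≢Q′ d∉) (off-arc⇒ccw P′≢Q′ c∉) adb abc

SegmentsMeet : Point → Point → Point → Point → Set
SegmentsMeet A B C D = Σ[ s ∈ ℚ ] Σ[ t ∈ ℚ ]
  (0ℚ ≤ s) × (s ≤ 1ℚ) × (0ℚ ≤ t) × (t ≤ 1ℚ) × (lerp s A B ≡ lerp t C D)

OppositeSigns : ℚ → ℚ → Set
OppositeSigns α β = (0ℚ < α × β < 0ℚ) ⊎ (α < 0ℚ × 0ℚ < β)

0≤1-t : t ≤ 1ℚ → 0ℚ ≤ 1ℚ - t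
0≤1-t {t} t≤1 = subst (_≤ 1ℚ - t) (ℚₚ.+-inverseʳ t) (ℚₚ.+-monoˡ-≤ (- t) t≤1)

interpolate-pos : 0ℚ ≤ t → t ≤ 1ℚ → 0ℚ < α → 0ℚ < β → 0ℚ < (1ℚ - t) * α + t * β
interpolate-pos {t} {α} {β} 0≤t t≤1 0<α 0<β with ℚₚ.<-cmp 0ℚ t
... | tri< 0<t _ _ = ℚₚ.+-mono-≤-< (0≤*0≤ (0≤1-t t≤1) (ℚₚ.<⇒≤ 0<α)) (0<*0< 0<t 0<β)
... | tri≈ _ refl _ = ℚₚ.+-mono-<-≤ (0<*0< (ℚₚ.positive⁻¹ 1ℚ) 0<α) (0≤*0≤ ℚₚ.≤-refl (ℚₚ.<⇒≤ 0<β))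
... | tri> _ _ t<0 = ⊥-elim (ℚₚ.<-irrefl {t} refl (ℚₚ.<-≤-trans t<0 0≤t))

interpolate-neg : ∀ t α β → (1ℚ - t) * (- α) + t * (- β) ≡ - ((1ℚ - t) * α + t * β)
interpolate-neg = solve 3 (λ t α β →
  (1ₑ :- t) :* (:- α) :+ t :* (:- β) := :- ((1ₑ :- t) :* α :+ t :* β)) refl

interpolate-zero : 0ℚ ≤ t → t ≤ 1ℚ → (1ℚ - t) * α + t * β ≡ 0ℚ → α ≢ 0ℚ → β ≢ 0ℚ →
  OppositeSigns α β
interpolate-zero {t} {α} {β} 0≤t t≤1 vanishes α≢0 β≢0 = signs (ℚₚ.<-cmp 0ℚ α) (ℚₚ.<-cmp 0ℚ β)
  where
  signs : Tri (0ℚ < α) (0ℚ ≡ α) (α < 0ℚ) → Tri (0ℚ < β) (0ℚ ≡ β) (β < 0ℚ) → OppositeSigns α β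
  signs (tri≈ _ 0≡α _) _ = ⊥-elim (α≢0 (sym 0≡α))
  signs _ (tri≈ _ 0≡β _) = ⊥-elim (β≢0 (sym 0≡β))
  signs (tri< 0<α _ _) (tri> _ _ β<0) = inj₁ (0<α , β<0)
  signs (tri> _ _ α<0) (tri< 0<β _ _) = inj₂ (α<0 , 0<β)
  signs (tri< 0<α _ _) (tri< 0<β _ _) =
    ⊥-elim (ℚₚ.<⇒≢ (interpolate-pos 0≤t t≤1 0<α 0<β) (sym vanishes))
  signs (tri> _ _ α<0) (tri> _ _ β<0) =
    ⊥-elim (ℚₚ.<⇒≢ (interpolate-pos 0≤t t≤1 (ℚₚ.neg-antimono-< α<0) (ℚₚ.neg-antimono-< β<0))
      (sym (trans (interpolate-neg t α β) (cong -_ vanishes))))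

opposite-signs⇒diff≢0 : OppositeSigns α β → α - β ≢ 0ℚ
opposite-signs⇒diff≢0 {α} {β} (inj₁ (0<α , β<0)) α-β≡0 =
  ℚₚ.<-asym 0<α (subst (_< 0ℚ) (sym (x∙y⁻¹≈ε⇒x≈y α β α-β≡0)) β<0)
opposite-signs⇒diff≢0 {α} {β} (inj₂ (α<0 , 0<β)) α-β≡0 =
  ℚₚ.<-asym α<0 (subst (0ℚ <_) (sym (x∙y⁻¹≈ε⇒x≈y α β α-β≡0)) 0<β)

positive-fraction : 0ℚ < α → 0ℚ < γ → Σ[ t ∈ ℚ ] (0ℚ ≤ t × t ≤ 1ℚ) × t * (α + γ) ≡ α
positive-fraction {α} {γ} 0<α 0<γ = τ , (0≤τ , τ≤1) , τ*D≡α
  where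
  D : ℚ
  D = α + γ
  instance
    D-pos : ℚ.Positive D
    D-pos = ℚ.positive (ℚₚ.+-mono-< {0ℚ} {_} {0ℚ} 0<α 0<γ)
    D-nonZero : ℚ.NonZero D
    D-nonZero = ℚₚ.pos⇒nonZero D
  τ : ℚ
  τ = α * 1/ D
  τ*D≡α : τ * D ≡ α
  τ*D≡α = begin
    α * 1/ D * D   ≡⟨ ℚₚ.*-assoc α (1/ D) D ⟩
    α * (1/ D * D) ≡⟨ cong (α *_) (ℚₚ.*-inverseˡ D) ⟩
    α * 1ℚ         ≡⟨ ℚₚ.*-identityʳ α ⟩
    α              ∎
    where open ≡-Reasoning
  0≤τ : 0ℚ ≤ τ
  0≤τ = ℚₚ.*-cancelʳ-≤-pos D (subst₂ _≤_ (sym (ℚₚ.*-zeroˡ D)) (sym τ*D≡α) (ℚₚ.<⇒≤ 0<α))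
  τ≤1 : τ ≤ 1ℚ
  τ≤1 = ℚₚ.*-cancelʳ-≤-pos D (subst₂ _≤_ (sym τ*D≡α) (sym (ℚₚ.*-identityˡ D))
    (subst (_≤ D) (ℚₚ.+-identityʳ α) (ℚₚ.+-monoʳ-≤ α (ℚₚ.<⇒≤ 0<γ))))

unit-fraction : OppositeSigns α β → Σ[ t ∈ ℚ ] (0ℚ ≤ t × t ≤ 1ℚ) × t * (α - β) ≡ α
unit-fraction (inj₁ (0<α , β<0)) = positive-fraction 0<α (ℚₚ.neg-antimono-< β<0)
unit-fraction {α} {β} (inj₂ (α<0 , 0<β)) with positive-fraction (ℚₚ.neg-antimono-< α<0) 0<β
... | t , bounds , t*D≡-α = t , bounds , ℚₚ.neg-injective (trans (flip-sign t) t*D≡-α)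
  where
  flip-sign : ∀ t → - (t * (α - β)) ≡ t * (- α + β)
  flip-sign t = solve 3 (λ t α β → :- (t :* (α :- β)) := t :* (:- α :+ β)) refl t α β

scale-lerp : ∀ s D {n} x y → s * D ≡ n → D * ((1ℚ - s) * x + s * y) ≡ (D - n) * x + n * y
scale-lerp s D x y refl =
  solve 4 (λ s D x y → D :* ((1ₑ :- s) :* x :+ s :* y) := (D :- s :* D) :* x :+ (s :* D) :* y)
    refl s D x y

-- The common point is the intersection of the two lines, with parameter s = γ/D₂ on one segment
-- and t = α/D₁ on the other; `key` is its defining identity with the denominators cleared.
meet-coordinate : ∀ s t {D₁ D₂} a b c d → D₁ ≢ 0ℚ → D₂ ≢ 0ℚ → s * D₂ ≡ γ → t * D₁ ≡ α →
  D₁ * ((D₂ - γ) * a + γ * b) ≡ D₂ * ((D₁ - α) * c + α * d) →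
  (1ℚ - s) * a + s * b ≡ (1ℚ - t) * c + t * d
meet-coordinate {γ} {α} s t {D₁} {D₂} a b c d D₁≢0 D₂≢0 sD₂≡γ tD₁≡α key =
  *-cancelˡ-≢0 D₂≢0 (*-cancelˡ-≢0 D₁≢0 (begin
    D₁ * (D₂ * X)                  ≡⟨ cong (D₁ *_) (scale-lerp s D₂ a b sD₂≡γ) ⟩
    D₁ * ((D₂ - γ) * a + γ * b)    ≡⟨ key ⟩
    D₂ * ((D₁ - α) * c + α * d)    ≡⟨ cong (D₂ *_) (scale-lerp t D₁ c d tD₁≡α) ⟨
    D₂ * (D₁ * Y)                  ≡⟨ ℚₚ.*-assoc D₂ D₁ Y ⟨
    D₂ * D₁ * Y                    ≡⟨ cong (_* Y) (ℚₚ.*-comm D₂ D₁) ⟩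
    D₁ * D₂ * Y                    ≡⟨ ℚₚ.*-assoc D₁ D₂ Y ⟩
    D₁ * (D₂ * Y)                  ∎))
  where
  open ≡-Reasoning
  X Y : ℚ
  X = (1ℚ - s) * a + s * b
  Y = (1ℚ - t) * c + t * d

intersection-identity : ∀ A B C D →
  let α = orient A C B ; β = orient A D B ; γ = orient C A D ; δ = orient C B D in
  ((α - β) * (((γ - δ) - γ) * proj₁ A + γ * proj₁ B)
     ≡ (γ - δ) * (((α - β) - α) * proj₁ C + α * proj₁ D))
  × ((α - β) * (((γ - δ) - γ) * proj₂ A + γ * proj₂ B)
     ≡ (γ - δ) * (((α - β) - α) * proj₂ C + α * proj₂ D))
intersection-identity (a₁ , a₂) (b₁ , b₂) (c₁ , c₂) (d₁ , d₂) =
  solve 8 (λ a₁ a₂ b₁ b₂ c₁ c₂ d₁ d₂ →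
    identity a₁ b₁ c₁ d₁ (a₁ , a₂) (b₁ , b₂) (c₁ , c₂) (d₁ , d₂)) refl a₁ a₂ b₁ b₂ c₁ c₂ d₁ d₂ ,
  solve 8 (λ a₁ a₂ b₁ b₂ c₁ c₂ d₁ d₂ →
    identity a₂ b₂ c₂ d₂ (a₁ , a₂) (b₁ , b₂) (c₁ , c₂) (d₁ , d₂)) refl a₁ a₂ b₁ b₂ c₁ c₂ d₁ d₂
  where
  identity : ∀ {m} → (a b c d : Polynomial m) → (A B C D : Vec²) → Polynomial m × Polynomial m
  identity a b c d A B C D =
    let α = orientₑ A C B ; β = orientₑ A D B ; γ = orientₑ C A D ; δ = orientₑ C B D in
    (α :- β) :* (((γ :- δ) :- γ) :* a :+ γ :* b) := (γ :- δ) :* (((α :- β) :- α) :* c :+ α :* d)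

opposite-signs⇒meet : ∀ A B C D →
  OppositeSigns (orient A C B) (orient A D B) → OppositeSigns (orient C A D) (orient C B D) →
  SegmentsMeet A B C D
opposite-signs⇒meet A B C D signs-AB signs-CD with unit-fraction signs-CD | unit-fraction signs-AB
... | s , (0≤s , s≤1) , sD₂≡γ | t , (0≤t , t≤1) , tD₁≡α =
  s , t , 0≤s , s≤1 , 0≤t , t≤1 ,
  cong₂ _,_
    (meet-coordinate s t _ _ _ _ D₁≢0 D₂≢0 sD₂≡γ tD₁≡α (proj₁ (intersection-identity A B C D)))
    (meet-coordinate s t _ _ _ _ D₁≢0 D₂≢0 sD₂≡γ tD₁≡α (proj₂ (intersection-identity A B C D)))
  where
  D₁≢0 : orient A C B - orient A D B ≢ 0ℚ
  D₁≢0 = opposite-signs⇒diff≢0 signs-AB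
  D₂≢0 : orient C A D - orient C B D ≢ 0ℚ
  D₂≢0 = opposite-signs⇒diff≢0 signs-CD

separated⇒meet : Separated a b c d → SegmentsMeet (coords a) (coords b) (coords c) (coords d)
separated⇒meet (inj₁ (acb , abd)) = opposite-signs⇒meet _ _ _ _
  (inj₁ (orient>0 acb , ccw⇒orient<0 abd))
  (inj₂ (ccw⇒orient<0 (ccw-rotate (ccw-trans acb abd)) , orient>0 (ccw-between acb abd)))
separated⇒meet (inj₂ (adb , abc)) = opposite-signs⇒meet _ _ _ _
  (inj₂ (ccw⇒orient<0 abc , orient>0 adb))
  (inj₁ (orient>0 (ccw-rotate (ccw-rotate (ccw-trans adb abc))) ,
         ccw⇒orient<0 (ccw-rotate (ccw-rotate (ccw-between adb abc)))))

meet⇒separated : a ≢ b → a ≢ c → a ≢ d → b ≢ c → b ≢ d →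
  SegmentsMeet (coords a) (coords b) (coords c) (coords d) → Separated a b c d
meet⇒separated {a} {b} {c} {d} a≢b a≢c a≢d b≢c b≢d (s , t , _ , _ , 0≤t , t≤1 , meet) =
  from-signs (interpolate-zero 0≤t t≤1 vanishes
    (orient≢0 a≢c (b≢c ∘ sym) (a≢b ∘ sym)) (orient≢0 a≢d (b≢d ∘ sym) (a≢b ∘ sym)))
  where
  A B C D : Point
  A = coords a
  B = coords b
  C = coords c
  D = coords d
  vanishes : (1ℚ - t) * orient A C B + t * orient A D B ≡ 0ℚ
  vanishes = trans (sym (orient-lerp A C D B t))
    (trans (cong (λ X → orient A X B) (sym meet)) (orient-lerp-self A B s))
  from-signs : OppositeSigns (orient A C B) (orient A D B) → Separated a b c d
  from-signs (inj₁ (0<acb , adb<0)) = inj₁ (ccw 0<acb , orient<0⇒ccw adb<0)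
  from-signs (inj₂ (acb<0 , 0<adb)) = inj₂ (ccw 0<adb , orient<0⇒ccw acb<0)

nonneg-sum-zeroˡ : 0ℚ ≤ p → 0ℚ ≤ q → p + q ≡ 0ℚ → p ≡ 0ℚ
nonneg-sum-zeroˡ {p} {q} 0≤p 0≤q p+q≡0 = ℚₚ.≤-antisym
  (subst₂ _≤_ (ℚₚ.+-identityʳ p) p+q≡0 (ℚₚ.+-monoʳ-≤ p 0≤q)) 0≤p

nonneg-sum-zeroʳ : 0ℚ ≤ p → 0ℚ ≤ q → p + q ≡ 0ℚ → q ≡ 0ℚ
nonneg-sum-zeroʳ {p} {q} 0≤p 0≤q p+q≡0 = nonneg-sum-zeroˡ 0≤q 0≤p (trans (ℚₚ.+-comm q p) p+q≡0)

sumFin-nonneg : ∀ {n} (f : Fin n → ℚ) → (∀ i → 0ℚ ≤ f i) → 0ℚ ≤ sumFin f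
sumFin-nonneg {zero}  f 0≤f = ℚₚ.≤-refl
sumFin-nonneg {suc n} f 0≤f = ℚₚ.+-mono-≤ (0≤f zero) (sumFin-nonneg (f ∘ suc) (0≤f ∘ suc))

sumFin-zero : ∀ {n} (f : Fin n → ℚ) → (∀ i → 0ℚ ≤ f i) → sumFin f ≡ 0ℚ → ∀ i → f i ≡ 0ℚ
sumFin-zero {suc n} f 0≤f Σf≡0 zero    =
  nonneg-sum-zeroˡ (0≤f zero) (sumFin-nonneg (f ∘ suc) (0≤f ∘ suc)) Σf≡0
sumFin-zero {suc n} f 0≤f Σf≡0 (suc i) = sumFin-zero (f ∘ suc) (0≤f ∘ suc)
  (nonneg-sum-zeroʳ (0≤f zero) (sumFin-nonneg (f ∘ suc) (0≤f ∘ suc)) Σf≡0) i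

sumFin-zeros : ∀ {n} (f : Fin n → ℚ) → (∀ i → f i ≡ 0ℚ) → sumFin f ≡ 0ℚ
sumFin-zeros {zero}  f f≡0 = refl
sumFin-zeros {suc n} f f≡0 = cong₂ _+_ (f≡0 zero) (sumFin-zeros (f ∘ suc) (f≡0 ∘ suc))

sumFin-versin : ∀ {n} (μ : Fin n → ℚ) (q : Fin n → Point) P →
  sumFin (λ i → μ i * versin P (q i))
    ≡ sumFin μ - dot P (sumFin (λ i → μ i * fstP (q i)) , sumFin (λ i → μ i * sndP (q i)))
sumFin-versin {zero}  μ q (p₁ , p₂) =
  solve 2 (λ p₁ p₂ → con 0ℚ := con 0ℚ :- (p₁ :* con 0ℚ :+ p₂ :* con 0ℚ)) refl p₁ p₂
sumFin-versin {suc n} μ q (p₁ , p₂) =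
  trans (cong (μ zero * versin (p₁ , p₂) (q zero) +_) (sumFin-versin (μ ∘ suc) (q ∘ suc) (p₁ , p₂)))
        (step (μ zero) (fstP (q zero)) (sndP (q zero)) _ _ _)
  where
  step : ∀ m x y S X Y → m * (1ℚ - (p₁ * x + p₂ * y)) + (S - (p₁ * X + p₂ * Y))
                         ≡ (m + S) - (p₁ * (m * x + X) + p₂ * (m * y + Y))
  step m x y S X Y = solve 8 (λ p₁ p₂ m x y S X Y →
    m :* (1ₑ :- (p₁ :* x :+ p₂ :* y)) :+ (S :- (p₁ :* X :+ p₂ :* Y))
      := (m :+ S) :- (p₁ :* (m :* x :+ X) :+ p₂ :* (m :* y :+ Y))) refl p₁ p₂ m x y S X Y

-- The weighted sum of versines from q v vanishes, which forces every weight to vanish.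
circle-convex : ∀ {n} (q : Fin n → Point) → (∀ v → onUnitCircle (q v)) →
  (∀ v w → v ≢ w → q v ≢ q w) → ConvexPosition q
circle-convex {n} q unit-q distinct v (μ , 0≤μ , μv≡0 , Σμ≡1 , Σx≡ , Σy≡) =
  1ℚ≢0ℚ (trans (sym Σμ≡1) (sumFin-zeros μ μ≡0))
  where
  1ℚ≢0ℚ : 1ℚ ≢ 0ℚ
  1ℚ≢0ℚ ()
  at : Fin n → CirclePoint
  at w = circlePoint (q w) (unit-q w)
  term : Fin n → ℚ
  term w = μ w * versin (q v) (q w)
  Σx Σy : ℚ
  Σx = sumFin (λ w → μ w * fstP (q w))
  Σy = sumFin (λ w → μ w * sndP (q w))
  Σterm≡0 : sumFin term ≡ 0ℚ
  Σterm≡0 = begin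
    sumFin term                        ≡⟨ sumFin-versin μ q (q v) ⟩
    sumFin μ - dot (q v) (Σx , Σy)     ≡⟨ cong₂ (λ S X → S - dot (q v) X) Σμ≡1 (cong₂ _,_ Σx≡ Σy≡) ⟩
    1ℚ - dot (q v) (q v)               ≡⟨ cong (λ r → 1ℚ - r) (unit-q v) ⟩
    0ℚ                                 ∎
    where open ≡-Reasoning
  term≡0 : ∀ w → term w ≡ 0ℚ
  term≡0 = sumFin-zero term (λ w → 0≤*0≤ (0≤μ w) (versin-nonneg (at v) (at w))) Σterm≡0
  weight≡0 : ∀ w → Dec (v ≡ w) → μ w ≡ 0ℚ
  weight≡0 w (yes refl) = μv≡0
  weight≡0 w (no v≢w)  = p*q≡0⇒p≡0 (ℚₚ.<⇒≢ 0<versin ∘ sym) (term≡0 w)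
    where
    0<versin : 0ℚ < versin (q v) (q w)
    0<versin = versin-pos {at v} {at w} (distinct v w v≢w ∘ cong coords)
  μ≡0 : ∀ w → μ w ≡ 0ℚ
  μ≡0 w = weight≡0 w (v Fin.≟ w)

AtMost : {A : Set} → ℕ → Pred A 0ℓ → Set
AtMost {A} m P = Σ[ xs ∈ List A ] length xs ℕ.≤ m × (∀ {x} → P x → x ∈ xs)

AtMost-pigeonhole : ∀ {A : Set} {m P} → AtMost m P →
  (f : Fin (suc m) → A) → Injective _≡_ _≡_ f → ¬ (∀ i → P (f i))
AtMost-pigeonhole (xs , len≤m , cover) f f-injective Pf
  with Finₚ.pigeonhole (s≤s len≤m) (λ i → index (cover (Pf i)))
... | i , j , i<j , same-slot = Finₚ.<⇒≢ i<j (f-injective (begin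
  f i                              ≡⟨ lookup-index (cover (Pf i)) ⟩
  lookup xs (index (cover (Pf i))) ≡⟨ cong (lookup xs) same-slot ⟩
  lookup xs (index (cover (Pf j))) ≡⟨ lookup-index (cover (Pf j)) ⟨
  f j                              ∎))
  where open ≡-Reasoning

AtMost-⊆ : ∀ {A : Set} {m} {P Q : Pred A 0ℓ} → (∀ {x} → Q x → P x) → AtMost m P → AtMost m Q
AtMost-⊆ Q⇒P (xs , len≤m , cover) = xs , len≤m , cover ∘ Q⇒P

AtMost-∪ : ∀ {A : Set} {m m′} {P Q : Pred A 0ℓ} → AtMost m P → AtMost m′ Q →
  AtMost (m ℕ.+ m′) (λ x → P x ⊎ Q x)
AtMost-∪ (xs , len≤m , cover) (ys , len≤m′ , cover′) =
  xs ++ ys , subst (ℕ._≤ _) (sym (Listₚ.length-++ xs)) (ℕₚ.+-mono-≤ len≤m len≤m′) ,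
  Sum.[ ∈-++⁺ˡ ∘ cover , ∈-++⁺ʳ xs ∘ cover′ ]

AtMost-weaken : ∀ {A : Set} {m m′} {P : Pred A 0ℓ} → m ℕ.≤ m′ → AtMost m P → AtMost m′ P
AtMost-weaken m≤m′ (xs , len≤m , cover) = xs , ℕₚ.≤-trans len≤m m≤m′ , cover

module InitialSegments {n} {_≺_ : Rel (Fin n) 0ℓ}
  (≺-isSPO : IsStrictPartialOrder _≡_ _≺_) (_≺?_ : Decidable _≺_) where

  TotalOn : Pred (Fin n) 0ℓ → Set
  TotalOn P = ∀ {u v} → P u → P v → u ≢ v → u ≺ v ⊎ v ≺ u

  record InitialSegment (P : Pred (Fin n) 0ℓ) (m : ℕ) : Set where
    field
      elem       : Fin m → Fin n
      satisfies  : ∀ i → P (elem i)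
      increasing : ∀ {i j} → i Fin.< j → elem i ≺ elem j
      few-below  : ∀ i → AtMost (toℕ i) (λ u → P u × u ≺ elem i)

  Minimal : Pred (Fin n) 0ℓ → Fin n → Set
  Minimal P v = P v × (∀ {w} → P w → ¬ w ≺ v)

  minimal : ∀ {P} → U.Decidable P → ∀ {u} → P u → ∃ (Minimal P)
  minimal {P} P? {u} Pu = descend Pu (spo-wellFounded ≺-isSPO u)
    where
    descend : ∀ {u} → P u → Acc _≺_ u → ∃ (Minimal P)
    descend {u} Pu (acc smaller) = step (Finₚ.any? (λ w → P? w ×-dec w ≺? u))
      where
      step : Dec (∃ λ w → P w × w ≺ u) → ∃ (Minimal P)
      step (yes (w , Pw , w≺u)) = descend Pw (smaller w≺u)
      step (no none)            = u , Pu , λ Pw w≺u → none (_ , Pw , w≺u)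

  module _ {P} (total : TotalOn P) {v} (v-min : Minimal P v) where

    Pv : P v
    Pv = proj₁ v-min

    v-minimal : ∀ {w} → P w → ¬ w ≺ v
    v-minimal = proj₂ v-min

    Above : Pred (Fin n) 0ℓ
    Above w = P w × v ≺ w

    minimum-or-above : ∀ {w} → P w → w ≡ v ⊎ v ≺ w
    minimum-or-above {w} Pw = from-dec (w Fin.≟ v)
      where
      from-dec : Dec (w ≡ v) → w ≡ v ⊎ v ≺ w
      from-dec (yes w≡v) = inj₁ w≡v
      from-dec (no w≢v)  = Sum.map₁ (⊥-elim ∘ v-minimal Pw) (total Pw Pv w≢v)

    add-minimum : ∀ {m R} → (∀ {w} → R w → P w) → AtMost m (λ w → R w × v ≺ w) → AtMost (suc m) R
    add-minimum {R = R} R⇒P (xs , len≤m , cover) = v ∷ xs , s≤s len≤m , from-split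
      where
      from-split : ∀ {w} → R w → w ∈ v ∷ xs
      from-split {w} Rw with minimum-or-above (R⇒P Rw)
      ... | inj₁ w≡v = here w≡v
      ... | inj₂ v≺w = there (cover (Rw , v≺w))

    cons : ∀ {m} → InitialSegment Above m → InitialSegment P (suc m)
    cons {m} S = record
      { elem = elem′ ; satisfies = satisfies′ ; increasing = increasing′ ; few-below = few-below′ }
      where
      open InitialSegment S
      elem′ : Fin (suc m) → Fin n
      elem′ zero    = v
      elem′ (suc i) = elem i
      satisfies′ : ∀ i → P (elem′ i)
      satisfies′ zero    = Pv
      satisfies′ (suc i) = proj₁ (satisfies i)
      increasing′ : ∀ {i j} → i Fin.< j → elem′ i ≺ elem′ j
      increasing′ {zero}  {suc j} _         = proj₂ (satisfies j)
      increasing′ {suc i} {suc j} (s≤s i<j) = increasing i<j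
      few-below′ : ∀ i → AtMost (toℕ i) (λ u → P u × u ≺ elem′ i)
      few-below′ zero    = [] , z≤n , λ (Pu , u≺v) → ⊥-elim (v-minimal Pu u≺v)
      few-below′ (suc i) = add-minimum proj₁ (AtMost-⊆ reassociate (few-below i))
        where
        reassociate : ∀ {u} → (P u × u ≺ elem i) × v ≺ u → Above u × u ≺ elem i
        reassociate ((Pu , u≺e) , v≺u) = (Pu , v≺u) , u≺e

  initial-segment : ∀ {P} → U.Decidable P → TotalOn P →
    ∀ m → InitialSegment P m ⊎ Σ[ l ∈ ℕ ] l ℕ.< m × AtMost l P
  initial-segment P? total zero = inj₁ (record
    { elem = λ () ; satisfies = λ () ; increasing = λ { {()} } ; few-below = λ () })
  initial-segment {P} P? total (suc m) = from-any (Finₚ.any? P?)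
    where
    from-any : Dec (∃ P) → InitialSegment P (suc m) ⊎ Σ[ l ∈ ℕ ] l ℕ.< suc m × AtMost l P
    from-any (no none)      = inj₂ (0 , s≤s z≤n , [] , z≤n , λ Pu → ⊥-elim (none (_ , Pu)))
    from-any (yes (u , Pu)) with minimal P? Pu
    ... | v , v-min = Sum.map (cons total v-min)
      (λ (l , l<m , few) → suc l , s≤s l<m , add-minimum total v-min id few)
      (initial-segment (λ w → P? w ×-dec v ≺? w) (λ Pu Pw → total (proj₁ Pu) (proj₁ Pw)) m)

opposite-< : ∀ {m} {i j : Fin m} → i Fin.< j → opposite j Fin.< opposite i
opposite-< {m} {i} {j} i<j =
  subst₂ ℕ._<_ (sym (Finₚ.opposite-prop j)) (sym (Finₚ.opposite-prop i))
    (ℕₚ.∸-monoʳ-< (s≤s i<j) (Finₚ.toℕ<n j))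

toℕ-opposite+toℕ : ∀ {k} (i : Fin (suc k)) → toℕ (opposite i) ℕ.+ toℕ i ≡ k
toℕ-opposite+toℕ {k} i =
  trans (cong (ℕ._+ toℕ i) (Finₚ.opposite-prop i)) (ℕₚ.m∸n+n≡m (ℕₚ.≤-pred (Finₚ.toℕ<n i)))

_∈ₑ_ : ∀ {n} → Fin n → Edge n → Set
v ∈ₑ (a , b) = v ≡ a ⊎ v ≡ b

crossing-ends-distinct : ∀ {n} {q : Fin n → Point} {e e′ v} →
  Cross q e e′ → v ∈ₑ e → v ∈ₑ e′ → ⊥
crossing-ends-distinct (a≢c , a≢d , b≢c , b≢d , _) (inj₁ refl) (inj₁ refl) = a≢c refl
crossing-ends-distinct (a≢c , a≢d , b≢c , b≢d , _) (inj₁ refl) (inj₂ refl) = a≢d refl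
crossing-ends-distinct (a≢c , a≢d , b≢c , b≢d , _) (inj₂ refl) (inj₁ refl) = b≢c refl
crossing-ends-distinct (a≢c , a≢d , b≢c , b≢d , _) (inj₂ refl) (inj₂ refl) = b≢d refl

cross-sym : ∀ {n} {q : Fin n → Point} {e e′} → Cross q e e′ → Cross q e′ e
cross-sym (a≢c , a≢d , b≢c , b≢d , s , t , 0≤s , s≤1 , 0≤t , t≤1 , meet) =
  (a≢c ∘ sym) , (b≢c ∘ sym) , (a≢d ∘ sym) , (b≢d ∘ sym) , t , s , 0≤t , t≤1 , 0≤s , s≤1 , sym meet

pairwise-crossing : ∀ {n m} {q : Fin n → Point} (e : Fin m → Edge n) →
  (∀ {i j} → i Fin.< j → Cross q (e i) (e j)) → ∀ i j → i ≢ j → Cross q (e i) (e j)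
pairwise-crossing {q = q} e cross-< i j i≢j with Finₚ.<-cmp i j
... | tri< i<j _ _ = cross-< i<j
... | tri≈ _ i≡j _ = ⊥-elim (i≢j i≡j)
... | tri> _ _ j<i = cross-sym {q = q} (cross-< j<i)

index-of-minimum : ∀ {m} (f : Fin (suc m) → ℚ) → Σ[ i ∈ Fin (suc m) ] ∀ j → f i ≤ f j
index-of-minimum f =
  argmin f zero (allFin _) , λ j → All.lookup (f[argmin]≤f[xs] {f = f} zero (allFin _)) (∈-allFin j)

module Representation {k n} {G : Graph n} {B : SemiBars n} (rep : IsCylSemiBarRep k G B) where

  foot : Fin n → CirclePoint
  foot v = circlePoint (pos B v) (onCircle B v)

  foot-≢ : ∀ {u v} → u ≢ v → foot u ≢ foot v
  foot-≢ {u} {v} u≢v = disjoint B u v u≢v ∘ cong coords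

  ≢-from-foot : ∀ {u v} → foot u ≢ foot v → u ≢ v
  ≢-from-foot feet-≢ = feet-≢ ∘ cong foot

  opposite-sides⇒Cross : ∀ {p q r s} →
    Ccw (foot p) (foot r) (foot q) → Ccw (foot p) (foot q) (foot s) → Cross (pos B) (p , q) (r , s)
  opposite-sides⇒Cross prq pqs =
    ≢-from-foot (ccw-≢₁₂ prq) , ≢-from-foot (ccw-≢₃₁ pqs ∘ sym) ,
    ≢-from-foot (ccw-≢₂₃ prq ∘ sym) , ≢-from-foot (ccw-≢₂₃ pqs) ,
    separated⇒meet (inj₁ (prq , pqs))

  ccw-chain⇒Cross : ∀ {b p q r s} →
    Ccw (foot b) (foot p) (foot q) → Ccw (foot b) (foot q) (foot r) → Ccw (foot b) (foot r) (foot s) →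
    Cross (pos B) (p , r) (q , s)
  ccw-chain⇒Cross bpq bqr brs =
    opposite-sides⇒Cross (ccw-between bpq bqr) (ccw-between (ccw-trans bpq bqr) brs)

  Cross⇒separated : ∀ {a b c d} → a ≢ b → Cross (pos B) (a , b) (c , d) →
    Separated (foot a) (foot b) (foot c) (foot d)
  Cross⇒separated a≢b (a≢c , a≢d , b≢c , b≢d , meet) =
    meet⇒separated (foot-≢ a≢b) (foot-≢ a≢c) (foot-≢ a≢d) (foot-≢ b≢c) (foot-≢ b≢d) meet

  sees-at-height : ∀ {u v} c → u ≢ v → 0ℚ ≤ c → c ≤ len B u → c ≤ len B v →
    AtMost k (λ w → c ≤ len B w × Ccw (foot u) (foot w) (foot v)) → Sees k B u v
  sees-at-height {u} {v} c u≢v 0≤c c≤u c≤v few =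
    sight , (0≤c , c≤u , inj₁ refl) , (0≤c , c≤v , inj₂ (inj₁ refl)) ,
    λ f f-injective others → AtMost-pigeonhole few f f-injective (tall-between ∘ others)
    where
    sight : Sightline
    sight = sightline c (ccwArc (pos B u) (pos B v))
      (onCircle B u , onCircle B v , disjoint B u v u≢v)
    tall-between : ∀ {w} → (w ≢ u) × (w ≢ v) × Meets B sight w →
      c ≤ len B w × Ccw (foot u) (foot w) (foot v)
    tall-between {w} (w≢u , w≢v , _ , c≤w , inj₁ w≡u)        = ⊥-elim (disjoint B w u w≢u w≡u)
    tall-between {w} (w≢u , w≢v , _ , c≤w , inj₂ (inj₁ w≡v)) = ⊥-elim (disjoint B w v w≢v w≡v)
    tall-between     (w≢u , w≢v , _ , c≤w , inj₂ (inj₂ uwv)) = c≤w , ccw uwv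

  shorter-end : Edge n → ℚ
  shorter-end (a , b) = len B a ⊓ len B b

  shorter-end-≤ : ∀ {v} e → v ∈ₑ e → shorter-end e ≤ len B v
  shorter-end-≤ (a , b) (inj₁ refl) = ℚₚ.p⊓q≤p (len B a) (len B b)
  shorter-end-≤ (a , b) (inj₂ refl) = ℚₚ.p⊓q≤q (len B a) (len B b)

  crossing-edge-meets-arc : ∀ {a b} e → a ≢ b → Cross (pos B) (a , b) e →
    ∀ A → IsArc A → OnArc (pos B a) A → OnArc (pos B b) A →
    Σ[ v ∈ Fin n ] v ∈ₑ e × OnArc (pos B v) A
  crossing-edge-meets-arc (c , d) a≢b ab×cd A A-arc a∈A b∈A =
    Sum.[ (λ c∈A → c , inj₁ refl , c∈A) , (λ d∈A → d , inj₂ refl , d∈A) ]′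
      (separated-meets-arc A A-arc a∈A b∈A (Cross⇒separated a≢b ab×cd))

  -- Every edge crossing ab has an end on the arc of s that is long enough to be met by s.
  crossing-edges-block-sightline : ∀ {a b} → a ≢ b → (s : Sightline) → Meets B s a → Meets B s b →
    (e : Fin (suc k) → Edge n) → (∀ i → Cross (pos B) (a , b) (e i)) →
    (∀ i j → i ≢ j → Cross (pos B) (e i) (e j)) → (∀ i → len B a ⊓ len B b ≤ shorter-end (e i)) →
    ¬ MeetsAtMostOthers k B s a b
  crossing-edges-block-sightline {a} {b} a≢b s (0≤x , x≤a , a∈s) (_ , x≤b , b∈s) e ab×e e×e long
    at-most = at-most end end-injective end-meets
    where
    met : ∀ i → Σ[ v ∈ Fin n ] v ∈ₑ e i × OnArc (pos B v) (arc s)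
    met i = crossing-edge-meets-arc (e i) a≢b (ab×e i) (arc s) (valid s) a∈s b∈s
    end : Fin (suc k) → Fin n
    end i = proj₁ (met i)
    end∈ : ∀ i → end i ∈ₑ e i
    end∈ i = proj₁ (proj₂ (met i))
    end-injective : Injective _≡_ _≡_ end
    end-injective {i} {j} same = decidable-stable (i Fin.≟ j) λ i≢j →
      crossing-ends-distinct {q = pos B} (e×e i j i≢j) (end∈ i)
        (subst (_∈ₑ e j) (sym same) (end∈ j))
    end-meets : ∀ i → (end i ≢ a) × (end i ≢ b) × Meets B s (end i)
    end-meets i =
      (λ end≡a → crossing-ends-distinct {q = pos B} (ab×e i) (inj₁ end≡a) (end∈ i)) ,
      (λ end≡b → crossing-ends-distinct {q = pos B} (ab×e i) (inj₂ end≡b) (end∈ i)) ,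
      0≤x , ℚₚ.≤-trans (ℚₚ.⊓-glb x≤a x≤b) (ℚₚ.≤-trans (long i) (shorter-end-≤ (e i) (end∈ i))) ,
      proj₂ (proj₂ (met i))

  edges-not-pairwise-crossing : ¬ PairwiseCrossingFamily (pos B) (IsEdge G) (2 ℕ.+ k)
  edges-not-pairwise-crossing (e , edge , e×e) = blocked-at (proj₁ shortest) (proj₂ shortest)
    where
    shortest : Σ[ i ∈ Fin (2 ℕ.+ k) ] ∀ j → shorter-end (e i) ≤ shorter-end (e j)
    shortest = index-of-minimum (shorter-end ∘ e)
    blocked-at : ∀ i₀ → (∀ j → shorter-end (e i₀) ≤ shorter-end (e j)) → ⊥
    blocked-at i₀ i₀-shortest = blocked (proj₁ (rep a₀ b₀ a₀≢b₀) (edge i₀))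
      where
      a₀ b₀ : Fin n
      a₀ = proj₁ (e i₀)
      b₀ = proj₂ (e i₀)
      a₀≢b₀ : a₀ ≢ b₀
      a₀≢b₀ a₀≡b₀ = irrefl G (subst (Adj G a₀) (sym a₀≡b₀) (edge i₀))
      blocked : Sees k B a₀ b₀ → ⊥
      blocked (sight , meets-a , meets-b , at-most) =
        crossing-edges-block-sightline a₀≢b₀ sight meets-a meets-b (e ∘ punchIn i₀)
          (λ j → e×e i₀ (punchIn i₀ j) (Finₚ.punchInᵢ≢i i₀ j ∘ sym))
          (λ i j i≢j → e×e (punchIn i₀ i) (punchIn i₀ j) (i≢j ∘ Finₚ.punchIn-injective i₀ i j))
          (i₀-shortest ∘ punchIn i₀)
          at-most

  module Saturation (len-injective : Injective _≡_ _≡_ (len B)) {a b} (b<a : len B b < len B a)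
    (a≁b : ¬ Adj G a b) where

    _≺_ : Rel (Fin n) 0ℓ
    u ≺ v = Ccw (foot b) (foot u) (foot v)

    _≺?_ : Decidable _≺_
    u ≺? v = map′ ccw orient>0 (0ℚ ℚₚ.<? orientᶜ (foot b) (foot u) (foot v))

    ≺-isSPO : IsStrictPartialOrder _≡_ _≺_
    ≺-isSPO = record
      { isEquivalence = isEquivalence
      ; irrefl        = λ { refl u≺u → ccw-≢₂₃ u≺u refl }
      ; trans         = ccw-trans
      ; <-resp-≈      = resp₂ _≺_
      }

    Taller : Pred (Fin n) 0ℓ
    Taller u = len B b < len B u

    taller⇒≢ : ∀ {u} → Taller u → u ≢ b
    taller⇒≢ b<u refl = ℚₚ.<-irrefl refl b<u

    ≺-total : ∀ {u v} → Taller u → Taller v → u ≢ v → u ≺ v ⊎ v ≺ u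
    ≺-total b<u b<v u≢v =
      ccw-total (foot-≢ (taller⇒≢ b<u ∘ sym)) (foot-≢ u≢v) (foot-≢ (taller⇒≢ b<v))

    BeforeA AfterA : Pred (Fin n) 0ℓ
    BeforeA u = Taller u × u ≺ a
    AfterA u = Taller u × a ≺ u

    module X = InitialSegments ≺-isSPO _≺?_
    module Y = InitialSegments (Flip.isStrictPartialOrder ≺-isSPO) (flip _≺?_)

    b≢a : b ≢ a
    b≢a = taller⇒≢ b<a ∘ sym

    taller-of : ∀ {w} → w ≢ b → len B b ≤ len B w → Taller w
    taller-of w≢b b≤w = ≤∧≢⇒< b≤w (w≢b ∘ len-injective ∘ sym)

    0≤len-b : 0ℚ ≤ len B b
    0≤len-b = ℚₚ.<⇒≤ (lenPos B b)

    few-before⇒adjacent : ∀ {l} → l ℕ.< suc k → AtMost l BeforeA → Adj G a b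
    few-before⇒adjacent l<1+k few = Graph.sym G (proj₂ (rep b a b≢a)
      (sees-at-height (len B b) b≢a 0≤len-b ℚₚ.≤-refl (ℚₚ.<⇒≤ b<a)
        (AtMost-weaken (ℕₚ.≤-pred l<1+k) (AtMost-⊆ before few))))
      where
      before : ∀ {w} → len B b ≤ len B w × Ccw (foot b) (foot w) (foot a) → BeforeA w
      before (b≤w , bwa) = taller-of (≢-from-foot (ccw-≢₁₂ bwa) ∘ sym) b≤w , bwa

    few-after⇒adjacent : ∀ {l} → l ℕ.< suc k → AtMost l AfterA → Adj G a b
    few-after⇒adjacent l<1+k few = proj₂ (rep a b (b≢a ∘ sym))
      (sees-at-height (len B b) (b≢a ∘ sym) 0≤len-b (ℚₚ.<⇒≤ b<a) ℚₚ.≤-refl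
        (AtMost-weaken (ℕₚ.≤-pred l<1+k) (AtMost-⊆ after few)))
      where
      after : ∀ {w} → len B b ≤ len B w × Ccw (foot a) (foot w) (foot b) → AfterA w
      after (b≤w , awb) = taller-of (≢-from-foot (ccw-≢₂₃ awb)) b≤w , ccw-rotate (ccw-rotate awb)

    before-segment : X.InitialSegment BeforeA (suc k)
    before-segment = Sum.[ id , (λ (_ , l<1+k , few) → ⊥-elim (a≁b (few-before⇒adjacent l<1+k few))) ]′
      (X.initial-segment (λ u → (len B b ℚₚ.<? len B u) ×-dec (u ≺? a))
        (λ before-u before-v → ≺-total (proj₁ before-u) (proj₁ before-v)) (suc k))

    after-segment : Y.InitialSegment AfterA (suc k)
    after-segment = Sum.[ id , (λ (_ , l<1+k , few) → ⊥-elim (a≁b (few-after⇒adjacent l<1+k few))) ]′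
      (Y.initial-segment (λ u → (len B b ℚₚ.<? len B u) ×-dec (a ≺? u))
        (λ after-u after-v u≢v → Sum.swap (≺-total (proj₁ after-u) (proj₁ after-v) u≢v)) (suc k))

    open X.InitialSegment before-segment
      renaming ( elem to left ; satisfies to left-before ; increasing to left-increasing
               ; few-below to few-below-left )
    open Y.InitialSegment after-segment
      renaming ( elem to right′ ; satisfies to right′-after ; increasing to right′-decreasing
               ; few-below to few-above-right′ )

    -- right is indexed so that, like left, it increases in the ccw order from b.
    right : Fin (suc k) → Fin n
    right i = right′ (opposite i)

    left≺a : ∀ i → left i ≺ a
    left≺a i = proj₂ (left-before i)

    a≺right : ∀ i → a ≺ right i
    a≺right i = proj₂ (right′-after (opposite i))

    right-increasing : ∀ {i j} → i Fin.< j → right i ≺ right j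
    right-increasing i<j = right′-decreasing (opposite-< i<j)

    chord-adjacent : ∀ i → Adj G (left i) (right i)
    chord-adjacent i = Graph.sym G (proj₂ (rep (right i) (left i) r≢l)
      (sees-at-height height r≢l (ℚₚ.<⇒≤ (ℚₚ.<-trans (lenPos B b) b<height))
        (ℚₚ.p⊓q≤p (len B (right i)) (len B (left i))) (ℚₚ.p⊓q≤q (len B (right i)) (len B (left i)))
        (subst (λ m → AtMost m Visible) (toℕ-opposite+toℕ i)
          (AtMost-⊆ split (AtMost-∪ (few-above-right′ (opposite i)) (few-below-left i))))))
      where
      height : ℚ
      height = len B (right i) ⊓ len B (left i)
      b<height : len B b < height
      b<height = <-⊓ (proj₁ (right′-after (opposite i))) (proj₁ (left-before i))
      l≺r : left i ≺ right i
      l≺r = ccw-trans (left≺a i) (a≺right i)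
      r≢l : right i ≢ left i
      r≢l = ≢-from-foot (ccw-≢₂₃ l≺r) ∘ sym
      Visible : Pred (Fin n) 0ℓ
      Visible w = height ≤ len B w × Ccw (foot (right i)) (foot w) (foot (left i))
      split : ∀ {w} → Visible w → (AfterA w × right i ≺ w) ⊎ (BeforeA w × w ≺ left i)
      split {w} (height≤w , rwl) =
        from-split (ccw-split (ccw-rotate (ccw-rotate l≺r)) rwl (foot-≢ (taller⇒≢ b<w)))
        where
        b<w : Taller w
        b<w = ℚₚ.<-≤-trans b<height height≤w
        from-split : w ≺ left i ⊎ Ccw (foot (right i)) (foot w) (foot b) →
          (AfterA w × right i ≺ w) ⊎ (BeforeA w × w ≺ left i)
        from-split (inj₁ w≺l) = inj₂ ((b<w , ccw-trans w≺l (left≺a i)) , w≺l)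
        from-split (inj₂ rwb) = inj₁ ((b<w , ccw-trans (a≺right i) r≺w) , r≺w)
          where
          r≺w : right i ≺ w
          r≺w = ccw-rotate (ccw-rotate rwb)

    chord : Fin (2 ℕ.+ k) → Edge n
    chord zero    = b , a
    chord (suc i) = left i , right i

    chord-allowed : ∀ i → IsEdge G (chord i) ⊎ chord i ≡ (b , a)
    chord-allowed zero    = inj₂ refl
    chord-allowed (suc i) = inj₁ (chord-adjacent i)

    chords-cross : ∀ {i j} → i Fin.< j → Cross (pos B) (chord i) (chord j)
    chords-cross {zero}  {suc j} _         = opposite-sides⇒Cross (left≺a j) (a≺right j)
    chords-cross {suc i} {suc j} (s≤s i<j) =
      ccw-chain⇒Cross (left-increasing i<j) (ccw-trans (left≺a j) (a≺right i)) (right-increasing i<j)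

    crossing-family : PairwiseCrossingFamily (pos B) (λ e → IsEdge G e ⊎ e ≡ (b , a)) (2 ℕ.+ k)
    crossing-family = chord , chord-allowed , pairwise-crossing {q = pos B} chord chords-cross

  nonadjacent⇒crossing-family : Injective _≡_ _≡_ (len B) → ∀ {a b} → a ≢ b → ¬ Adj G a b →
    PairwiseCrossingFamily (pos B) (λ e → IsEdge G e ⊎ e ≡ (a , b) ⊎ e ≡ (b , a)) (2 ℕ.+ k)
  nonadjacent⇒crossing-family len-injective {a} {b} a≢b a≁b with ℚₚ.<-cmp (len B a) (len B b)
  ... | tri< a<b _ _ =
    let (e , allowed , crossing) = Saturation.crossing-family len-injective a<b (a≁b ∘ Graph.sym G)
    in e , Sum.map₂ inj₁ ∘ allowed , crossing
  ... | tri≈ _ same _ = ⊥-elim (a≢b (len-injective same))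
  ... | tri> _ _ b<a =
    let (e , allowed , crossing) = Saturation.crossing-family len-injective b<a a≁b
    in e , Sum.map₂ inj₂ ∘ allowed , crossing

theorem4 : (k n : ℕ) (G : Graph n) →
    HasCylSemiBarRepDistinctLengths k G →
    Σ (ConvexGeomRep G) (λ C → MaximalQuasiplanar k C)
theorem4 k n G (B , rep , len-injective) = C , quasiplanar , maximal
  where
  open Representation {k = k} {G = G} {B = B} rep
  C : ConvexGeomRep G
  C = record { pt = pos B ; convex = circle-convex (pos B) (onCircle B) (disjoint B) }
  2+k≡k+2 : 2 ℕ.+ k ≡ k ℕ.+ 2
  2+k≡k+2 = ℕₚ.+-comm 2 k
  quasiplanar : Quasiplanar k C
  quasiplanar = subst (λ m → ¬ PairwiseCrossingFamily (pos B) (IsEdge G) m) 2+k≡k+2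
    edges-not-pairwise-crossing
  maximal : ∀ a b → a ≢ b → ¬ Adj G a b →
    PairwiseCrossingFamily (pos B) (λ e → IsEdge G e ⊎ e ≡ (a , b) ⊎ e ≡ (b , a)) (k ℕ.+ 2)
  maximal a b a≢b a≁b =
    subst (PairwiseCrossingFamily (pos B) (λ e → IsEdge G e ⊎ e ≡ (a , b) ⊎ e ≡ (b , a))) 2+k≡k+2
      (nonadjacent⇒crossing-family len-injective a≢b a≁b)
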